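{- If there exists an $(h,k)_q$-evasive subspace $U$ of $\mathbb{F}_q$-dimension $t$ in $V(r,q^n)$, then for each integer $s$ with $0\le s\le rn-t$ there also exists an $(h,k+s)_q$-evasive subspace of $V(r,q^n)$ of $\mathbb{F}_q$-dimension $t+s$.
   Context: $V(r,q^n)$ denotes an $r$-dimensional vector space over $\mathbb{F}_{q^n}$, viewed also as an $rn$-dimensional vector space over $\mathbb{F}_q$. For positive integers $h,k$, an $\mathbb{F}_q$-subspace $U$ of $V(r,q^n)$ is called $(h,k)_q$-evasive if $\langle U\rangle_{\mathbb{F}_{q^n}}$ has $\mathbb{F}_{q^n}$-dimension at least $h$ and every $h$-dimensional $\mathbb{F}_{q^n}$-subspace meets $U$ in an $\mathbb{F}_q$-subspace of $\mathbb{F}_q$-dimension at most $k$. -}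

module Defs where

open import Data.Nat using (ℕ; zero; suc; _^_; _≤_)
open import Data.Fin using (Fin; zero; suc)
open import Data.Bool using (Bool; T)
open import Data.Product using (Σ; ∃; _×_; _,_)
open import Function.Bundles using (_↔_)
open import Relation.Nullary using (¬_)
open import Relation.Binary.PropositionalEquality using (_≡_; _≢_)
open import Algebra.Structures using (IsCommutativeRing)

-- A finite field F of order q^n (playing F_{q^n}) together with its subfield
-- K of order q (playing F_q).  K is given by a Boolean membership test, so
-- that  Σ F (T ∘ inK)  is really the set of elements of K.
record FieldExt (q n : ℕ) : Set₁ where
  infixl 6 _+_
  infixl 7 _*_
  field
    F     : Set
    _+_   : F → F → F
    _*_   : F → F → F
    -_    : F → F
    0#    : F
    1#    : F
    isCommutativeRing : IsCommutativeRing _≡_ _+_ _*_ -_ 0# 1#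
    1≢0   : 1# ≢ 0#
    inverse : ∀ x → x ≢ 0# → Σ F (λ y → x * y ≡ 1#)
    F-card : F ↔ Fin (q ^ n)
    inK   : F → Bool
    K-0   : T (inK 0#)
    K-1   : T (inK 1#)
    K-+   : ∀ x y → T (inK x) → T (inK y) → T (inK (x + y))
    K-*   : ∀ x y → T (inK x) → T (inK y) → T (inK (x * y))
    K-neg : ∀ x → T (inK x) → T (inK (- x))
    K-inv : ∀ x (x≢0 : x ≢ 0#) → T (inK x) →
            let (y , _) = inverse x x≢0 in T (inK y)
    K-card : Σ F (λ x → T (inK x)) ↔ Fin q

module VSpace {q n : ℕ} (E : FieldExt q n) (r : ℕ) where
  open FieldExt E

  K : F → Set
  K x = T (inK x)

  V : Set
  V = Fin r → F

  _≈_ : V → V → Set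
  u ≈ v = ∀ j → u j ≡ v j

  0V : V
  0V j = 0#

  _+V_ : V → V → V
  (u +V v) j = u j + v j

  _·_ : F → V → V
  (c · v) j = c * v j

  lincomb : (m : ℕ) → (Fin m → F) → (Fin m → V) → V
  lincomb zero    c v = 0V
  lincomb (suc m) c v = (c zero · v zero) +V lincomb m (λ i → c (suc i)) (λ i → v (suc i))

  Pred : Set₁
  Pred = V → Set

  _∩_ : Pred → Pred → Pred
  (U ∩ W) v = U v × W v

  IndepF : (m : ℕ) → (Fin m → V) → Set
  IndepF m v = ∀ (c : Fin m → F) → lincomb m c v ≈ 0V → ∀ i → c i ≡ 0#

  IndepK : (m : ℕ) → (Fin m → V) → Set
  IndepK m v = ∀ (c : Fin m → F) → (∀ i → K (c i)) → lincomb m c v ≈ 0V → ∀ i → c i ≡ 0#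

  IsFqSubspace : Pred → Set
  IsFqSubspace U = (∀ u v → u ≈ v → U u → U v)
                 × U 0V
                 × (∀ u v → U u → U v → U (u +V v))
                 × (∀ c u → K c → U u → U (c · u))

  IsFqnSubspace : Pred → Set
  IsFqnSubspace W = (∀ u v → u ≈ v → W u → W v)
                  × W 0V
                  × (∀ u v → W u → W v → W (u +V v))
                  × (∀ c u → W u → W (c · u))

  HasDimFq : Pred → ℕ → Set
  HasDimFq U d = Σ (Fin d → V) λ b → (∀ i → U (b i)) × IndepK d b
               × (∀ u → U u → Σ (Fin d → F) λ c → (∀ i → K (c i)) × (u ≈ lincomb d c b))

  HasDimFqn : Pred → ℕ → Set
  HasDimFqn W d = Σ (Fin d → V) λ b → (∀ i → W (b i)) × IndepF d b
                × (∀ u → W u → Σ (Fin d → F) λ c → u ≈ lincomb d c b)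

  DimFq≤ : Pred → ℕ → Set
  DimFq≤ X k = ∀ m (v : Fin m → V) → (∀ i → X (v i)) → IndepK m v → m ≤ k

  SpanFqn : Pred → Pred
  SpanFqn U v = Σ ℕ λ m → Σ (Fin m → V) λ w → Σ (Fin m → F) λ c →
                (∀ i → U (w i)) × (v ≈ lincomb m c w)

  DimFqn≥ : Pred → ℕ → Set
  DimFqn≥ X h = Σ (Fin h → V) λ b → (∀ i → X (b i)) × IndepF h b

  Evasive : ℕ → ℕ → Pred → Set₁
  Evasive h k U = IsFqSubspace U
                × DimFqn≥ (SpanFqn U) h
                × (∀ (W : Pred) → IsFqnSubspace W → HasDimFqn W h → DimFq≤ (U ∩ W) k)

module Submission where

open import Defs
open import Data.Nat using (ℕ; zero; suc; z≤n; s≤s; _+_; _*_; _^_; _∸_; _≤_; _<_)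
import Data.Nat.Properties as ℕ
open import Data.Fin using (Fin; zero; suc; punchIn; finToFun; funToFin; combine)
open import Data.Fin.Properties
  using (any?; all?; injective⇒≤; funToFin-finToFin; finToFun-funToFin)
  renaming (_≟_ to _≟Fin_)
open import Data.Vec.Functional using (_∷_; insertAt)
open import Data.Vec.Functional.Properties using (insertAt-punchIn)
open import Data.Product using (Σ; _×_; _,_; proj₁; proj₂)
open import Data.Bool using (T)
open import Data.Bool.Properties using (T?)
open import Data.Empty using (⊥-elim)
open import Function using (_∘_)
open import Function.Bundles using (Inverse; Injection)
open import Function.Properties.Inverse using (Inverse⇒Injection)
open import Relation.Nullary using (¬_; Dec; yes; no; ¬?)
open import Relation.Nullary.Decidable using (map′; via-injection; decidable-stable; _×-dec_)
open import Relation.Binary.PropositionalEquality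
open import Algebra.Bundles using (CommutativeRing)

-- It suffices to raise the dimension by one: given an (h,k)_q-evasive U with
-- F_q-basis b_1..b_d and d < rn, pick v outside ⟨b⟩_{F_q} and put
-- Z = ⟨v, b_1, ..., b_d⟩_{F_q}.  Then Z has dimension d+1, contains U (so its
-- F_{q^n}-span still has dimension ≥ h), and Z is (h,k+1)_q-evasive: if
-- w_0..w_m ∈ Z ∩ W are F_q-independent, write w_i = a_i v + y_i with y_i ∈ U,
-- pick a pivot a_p ≠ 0 and eliminate v by the row operations w_i - (a_i/a_p) w_p
-- (if all a_i = 0, just drop w_0); this leaves m independent vectors of U ∩ W,
-- so m ≤ k.  A vector v outside the F_q-span exists by counting: if d vectors
-- spanned all of V then q^{rn} = |V| ≤ |F_q^d| = q^d.  Iterating s times proves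
-- the proposition.

-- The base-k digit encoding of functions Fin m → Fin k by Fin (k ^ m) respects and
-- reflects pointwise equality (used to enumerate coefficient vectors without funext).
funToFin-cong : ∀ {m k} {f g : Fin m → Fin k} → (∀ j → f j ≡ g j) → funToFin f ≡ funToFin g
funToFin-cong {zero}  f≗g = refl
funToFin-cong {suc m} f≗g = cong₂ combine (f≗g zero) (funToFin-cong (f≗g ∘ suc))

finToFun-injective : ∀ {m k} {i j : Fin (k ^ m)} → (∀ x → finToFun {k} {m} i x ≡ finToFun j x) → i ≡ j
finToFun-injective {m} {k} {i} {j} eq = begin
  i                              ≡⟨ sym (funToFin-finToFin {m} {k} i) ⟩
  funToFin (finToFun {k} {m} i)  ≡⟨ funToFin-cong eq ⟩
  funToFin (finToFun {k} {m} j)  ≡⟨ funToFin-finToFin {m} {k} j ⟩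
  j                              ∎
  where open ≡-Reasoning

insertAt-all : ∀ {a ℓ} {A : Set a} (P : A → Set ℓ) {m} (c : Fin m → A) (p : Fin (suc m)) (S : A) →
               P S → (∀ i → P (c i)) → ∀ j → P (insertAt c p S j)
insertAt-all P         c zero    S PS Pc zero    = PS
insertAt-all P         c zero    S PS Pc (suc j) = Pc j
insertAt-all P {suc m} c (suc p) S PS Pc zero    = Pc zero
insertAt-all P {suc m} c (suc p) S PS Pc (suc j) = insertAt-all P (c ∘ suc) p S PS (Pc ∘ suc) j

two-elements⇒1< : ∀ {m} (i j : Fin m) → i ≢ j → 1 < m
two-elements⇒1< {suc zero}    zero zero i≢j = ⊥-elim (i≢j refl)
two-elements⇒1< {suc (suc m)} _    _    _   = s≤s (s≤s z≤n)

^-reflects-≤ : ∀ {q n r d} → 1 < q → (q ^ n) ^ r ≤ q ^ d → r * n ≤ d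
^-reflects-≤ {q} {n} {r} {d} 1<q le = ℕ.≮⇒≥ λ d<rn →
  ℕ.<⇒≱ (ℕ.^-monoʳ-< q 1<q d<rn) (subst (_≤ q ^ d) q^n^r≡q^rn le)
  where
    q^n^r≡q^rn : (q ^ n) ^ r ≡ q ^ (r * n)
    q^n^r≡q^rn = trans (ℕ.^-*-assoc q n r) (cong (q ^_) (ℕ.*-comm n r))

room-for-one-more : ∀ s t N → suc s ≤ N ∸ t → s + t < N
room-for-one-more s t N le = ℕ.m≤o∸n⇒m+n≤o (suc s) (ℕ.<⇒≤ t<N) le
  where
    t<N : t < N
    t<N = ℕ.m∸n≢0⇒n<m λ N∸t≡0 → ℕ.<⇒≱ (ℕ.≤-trans (s≤s z≤n) le) (ℕ.≤-reflexive N∸t≡0)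

module FieldFacts {q n : ℕ} (E : FieldExt q n) where
  open FieldExt E public renaming (_+_ to _⊕_; _*_ to _⊗_; -_ to ⊖_)

  private
    commRing : CommutativeRing _ _
    commRing = record { isCommutativeRing = isCommutativeRing }
  open CommutativeRing commRing public
    using (+-assoc; +-comm; +-identityˡ; +-identityʳ; -‿inverseʳ;
           *-assoc; *-comm; *-identityˡ; *-identityʳ; distribˡ; distribʳ; zeroˡ; zeroʳ)
  open CommutativeRing commRing using (+-commutativeSemigroup; +-abelianGroup; ring)
  open import Algebra.Properties.CommutativeSemigroup +-commutativeSemigroup public
    using (interchange)
  open import Algebra.Properties.AbelianGroup +-abelianGroup public using (inverseˡ-unique)
  open import Algebra.Properties.Ring ring public using (-‿distribˡ-*; -‿distribʳ-*)
  open ≡-Reasoning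

  K : F → Set
  K x = T (inK x)

  _≟F_ : (x y : F) → Dec (x ≡ y)
  _≟F_ = via-injection (Inverse⇒Injection F-card) _≟Fin_

  1<q : 1 < q
  1<q = two-elements⇒1< (toK (0# , K-0)) (toK (1# , K-1))
          (λ eq → 1≢0 (sym (cong proj₁ (Injection.injective (Inverse⇒Injection K-card) eq))))
    where
      toK : Σ F K → Fin q
      toK = Inverse.to K-card

  decode : ∀ {m} → Fin ((q ^ n) ^ m) → Fin m → F
  decode i j = Inverse.from F-card (finToFun i j)

  encode : ∀ {m} → (Fin m → F) → Fin ((q ^ n) ^ m)
  encode c = funToFin (Inverse.to F-card ∘ c)

  decode-encode : ∀ {m} (c : Fin m → F) → ∀ j → decode (encode c) j ≡ c j
  decode-encode c j = begin
    Inverse.from F-card (finToFun (encode c) j)    ≡⟨ cong (Inverse.from F-card) (finToFun-funToFin _ j) ⟩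
    Inverse.from F-card (Inverse.to F-card (c j))  ≡⟨ Inverse.strictlyInverseʳ F-card (c j) ⟩
    c j                                            ∎

  decode-injective : ∀ {m} {i i′ : Fin ((q ^ n) ^ m)} → (∀ j → decode i j ≡ decode i′ j) → i ≡ i′
  decode-injective {m} {i} {i′} eq = finToFun-injective {m} λ j → begin
    finToFun i j                        ≡⟨ sym (Inverse.strictlyInverseˡ F-card _) ⟩
    Inverse.to F-card (decode i j)      ≡⟨ cong (Inverse.to F-card) (eq j) ⟩
    Inverse.to F-card (decode i′ j)     ≡⟨ Inverse.strictlyInverseˡ F-card _ ⟩
    finToFun i′ j                       ∎

  search : ∀ m (P : (Fin m → F) → Set) →
           (∀ {c c′} → (∀ j → c j ≡ c′ j) → P c → P c′) → (∀ c → Dec (P c)) →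
           Dec (Σ (Fin m → F) P)
  search m P resp P? = map′ (λ (i , p) → decode i , p)
                            (λ (c , p) → encode c , resp (sym ∘ decode-encode c) p)
                            (any? (P? ∘ decode))

  -- Choosing a pivot: among K-scalars a_0..a_m pick p and K-multipliers γ that
  -- clear every other entry, a_{p↑i} + γ_i a_p = 0.  If some a_p ≠ 0 take
  -- γ_i = -a_{p↑i}/a_p; if all a_i vanish, p = 0 and γ = 0 work.
  Pivot : ∀ m → (Fin (suc m) → F) → Set
  Pivot m a = Σ (Fin (suc m)) λ p → Σ (Fin m → F) λ γ →
              (∀ i → K (γ i)) × (∀ i → a (punchIn p i) ⊕ γ i ⊗ a p ≡ 0#)

  pivot : ∀ m (a : Fin (suc m) → F) → (∀ i → K (a i)) → Pivot m a
  pivot m a Ka with any? (λ i → ¬? (a i ≟F 0#))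
  ... | yes (p , ap≢0) = p , γ , (λ i → K-neg _ (K-* _ _ (Ka _) Kβ)) , cleared
    where
      β : F
      β = proj₁ (inverse (a p) ap≢0)
      Kβ : K β
      Kβ = K-inv (a p) ap≢0 (Ka p)
      γ : Fin m → F
      γ i = ⊖ (a (punchIn p i) ⊗ β)
      cleared : ∀ i → a (punchIn p i) ⊕ γ i ⊗ a p ≡ 0#
      cleared i = let A = a (punchIn p i) in begin
        A ⊕ (⊖ (A ⊗ β)) ⊗ a p  ≡⟨ cong (A ⊕_) (sym (-‿distribˡ-* _ _)) ⟩
        A ⊕ ⊖ ((A ⊗ β) ⊗ a p)  ≡⟨ cong (λ x → A ⊕ ⊖ x) (*-assoc _ _ _) ⟩
        A ⊕ ⊖ (A ⊗ (β ⊗ a p))  ≡⟨ cong (λ x → A ⊕ ⊖ (A ⊗ x)) (trans (*-comm _ _) (proj₂ (inverse (a p) ap≢0))) ⟩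
        A ⊕ ⊖ (A ⊗ 1#)         ≡⟨ cong (λ x → A ⊕ ⊖ x) (*-identityʳ A) ⟩
        A ⊕ ⊖ A                ≡⟨ -‿inverseʳ A ⟩
        0#                     ∎
  ... | no all-zero = zero , (λ _ → 0#) , (λ _ → K-0) , cleared
    where
      cleared : ∀ i → a (suc i) ⊕ 0# ⊗ a zero ≡ 0#
      cleared i = begin
        a (suc i) ⊕ 0# ⊗ a zero  ≡⟨ cong₂ _⊕_ (decidable-stable (a (suc i) ≟F 0#) (λ ne → all-zero (suc i , ne)))
                                              (zeroˡ _) ⟩
        0# ⊕ 0#                  ≡⟨ +-identityˡ 0# ⟩
        0#                       ∎

  row-operation : ∀ A B γ x Y Z → A ⊕ γ ⊗ B ≡ 0# →
                  (A ⊗ x ⊕ Y) ⊕ γ ⊗ (B ⊗ x ⊕ Z) ≡ Y ⊕ γ ⊗ Z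
  row-operation A B γ x Y Z cleared = begin
    (A ⊗ x ⊕ Y) ⊕ γ ⊗ (B ⊗ x ⊕ Z)        ≡⟨ cong ((A ⊗ x ⊕ Y) ⊕_) (distribˡ γ _ _) ⟩
    (A ⊗ x ⊕ Y) ⊕ (γ ⊗ (B ⊗ x) ⊕ γ ⊗ Z)  ≡⟨ interchange _ _ _ _ ⟩
    (A ⊗ x ⊕ γ ⊗ (B ⊗ x)) ⊕ (Y ⊕ γ ⊗ Z)  ≡⟨ cong (λ u → (A ⊗ x ⊕ u) ⊕ (Y ⊕ γ ⊗ Z)) (sym (*-assoc γ B x)) ⟩
    (A ⊗ x ⊕ (γ ⊗ B) ⊗ x) ⊕ (Y ⊕ γ ⊗ Z)  ≡⟨ cong (_⊕ (Y ⊕ γ ⊗ Z)) (sym (distribʳ x A _)) ⟩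
    (A ⊕ γ ⊗ B) ⊗ x ⊕ (Y ⊕ γ ⊗ Z)        ≡⟨ cong (λ u → u ⊗ x ⊕ (Y ⊕ γ ⊗ Z)) cleared ⟩
    0# ⊗ x ⊕ (Y ⊕ γ ⊗ Z)                 ≡⟨ cong (_⊕ (Y ⊕ γ ⊗ Z)) (zeroˡ x) ⟩
    0# ⊕ (Y ⊕ γ ⊗ Z)                     ≡⟨ +-identityˡ _ ⟩
    Y ⊕ γ ⊗ Z                            ∎

module Extension {q n : ℕ} (E : FieldExt q n) (r : ℕ) where
  open FieldFacts E
  open VSpace E r hiding (K)
  open ≡-Reasoning

  _⊆_ : Pred → Pred → Set
  X ⊆ X′ = ∀ u → X u → X′ u

  ≈-sym : ∀ {u w} → u ≈ w → w ≈ u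
  ≈-sym u≈w j = sym (u≈w j)

  ≈-trans : ∀ {u w x} → u ≈ w → w ≈ x → u ≈ x
  ≈-trans u≈w w≈x j = trans (u≈w j) (w≈x j)

  lincomb-cong : ∀ m {c c′ : Fin m → F} (v : Fin m → V) → (∀ i → c i ≡ c′ i) →
                 lincomb m c v ≈ lincomb m c′ v
  lincomb-cong zero    v c≗c′ j = refl
  lincomb-cong (suc m) v c≗c′ j =
    cong₂ (λ a x → a ⊗ v zero j ⊕ x) (c≗c′ zero) (lincomb-cong m (v ∘ suc) (c≗c′ ∘ suc) j)

  lincomb-zero : ∀ m (v : Fin m → V) → lincomb m (λ _ → 0#) v ≈ 0V
  lincomb-zero zero    v j = refl
  lincomb-zero (suc m) v j = begin
    0# ⊗ v zero j ⊕ lincomb m (λ _ → 0#) (v ∘ suc) j  ≡⟨ cong₂ _⊕_ (zeroˡ _) (lincomb-zero m (v ∘ suc) j) ⟩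
    0# ⊕ 0#                                          ≡⟨ +-identityˡ 0# ⟩
    0#                                               ∎

  lincomb-+ : ∀ m (c c′ : Fin m → F) (v : Fin m → V) →
              lincomb m (λ i → c i ⊕ c′ i) v ≈ (lincomb m c v +V lincomb m c′ v)
  lincomb-+ zero    c c′ v j = sym (+-identityˡ 0#)
  lincomb-+ (suc m) c c′ v j = begin
    (c zero ⊕ c′ zero) ⊗ v zero j ⊕ lincomb m (λ i → c (suc i) ⊕ c′ (suc i)) (v ∘ suc) j
      ≡⟨ cong₂ _⊕_ (distribʳ _ _ _) (lincomb-+ m (c ∘ suc) (c′ ∘ suc) (v ∘ suc) j) ⟩
    (c zero ⊗ v zero j ⊕ c′ zero ⊗ v zero j) ⊕ (lincomb m (c ∘ suc) (v ∘ suc) j ⊕ lincomb m (c′ ∘ suc) (v ∘ suc) j)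
      ≡⟨ interchange _ _ _ _ ⟩
    (c zero ⊗ v zero j ⊕ lincomb m (c ∘ suc) (v ∘ suc) j) ⊕ (c′ zero ⊗ v zero j ⊕ lincomb m (c′ ∘ suc) (v ∘ suc) j)
      ∎

  lincomb-scale : ∀ m (a : F) (c : Fin m → F) (v : Fin m → V) →
                  lincomb m (λ i → a ⊗ c i) v ≈ (a · lincomb m c v)
  lincomb-scale zero    a c v j = sym (zeroʳ a)
  lincomb-scale (suc m) a c v j = begin
    (a ⊗ c zero) ⊗ v zero j ⊕ lincomb m (λ i → a ⊗ c (suc i)) (v ∘ suc) j
      ≡⟨ cong₂ _⊕_ (*-assoc _ _ _) (lincomb-scale m a (c ∘ suc) (v ∘ suc) j) ⟩
    a ⊗ (c zero ⊗ v zero j) ⊕ a ⊗ lincomb m (c ∘ suc) (v ∘ suc) j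
      ≡⟨ sym (distribˡ _ _ _) ⟩
    a ⊗ (c zero ⊗ v zero j ⊕ lincomb m (c ∘ suc) (v ∘ suc) j)
      ∎

  lincomb-+V : ∀ m (c : Fin m → F) (v v′ : Fin m → V) →
               lincomb m c (λ i → v i +V v′ i) ≈ (lincomb m c v +V lincomb m c v′)
  lincomb-+V zero    c v v′ j = sym (+-identityˡ 0#)
  lincomb-+V (suc m) c v v′ j = begin
    c zero ⊗ (v zero j ⊕ v′ zero j) ⊕ lincomb m (c ∘ suc) (λ i → v (suc i) +V v′ (suc i)) j
      ≡⟨ cong₂ _⊕_ (distribˡ _ _ _) (lincomb-+V m (c ∘ suc) (v ∘ suc) (v′ ∘ suc) j) ⟩
    (c zero ⊗ v zero j ⊕ c zero ⊗ v′ zero j) ⊕ (lincomb m (c ∘ suc) (v ∘ suc) j ⊕ lincomb m (c ∘ suc) (v′ ∘ suc) j)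
      ≡⟨ interchange _ _ _ _ ⟩
    (c zero ⊗ v zero j ⊕ lincomb m (c ∘ suc) (v ∘ suc) j) ⊕ (c zero ⊗ v′ zero j ⊕ lincomb m (c ∘ suc) (v′ ∘ suc) j)
      ∎

  dot : ∀ m → (Fin m → F) → (Fin m → F) → F
  dot zero    c g = 0#
  dot (suc m) c g = c zero ⊗ g zero ⊕ dot m (c ∘ suc) (g ∘ suc)

  dot-K : ∀ m (c g : Fin m → F) → (∀ i → K (c i)) → (∀ i → K (g i)) → K (dot m c g)
  dot-K zero    c g Kc Kg = K-0
  dot-K (suc m) c g Kc Kg =
    K-+ _ _ (K-* _ _ (Kc zero) (Kg zero)) (dot-K m (c ∘ suc) (g ∘ suc) (Kc ∘ suc) (Kg ∘ suc))

  lincomb-multiples : ∀ m (c g : Fin m → F) (u : V) → lincomb m c (λ i → g i · u) ≈ (dot m c g · u)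
  lincomb-multiples zero    c g u j = sym (zeroˡ _)
  lincomb-multiples (suc m) c g u j = begin
    c zero ⊗ (g zero ⊗ u j) ⊕ lincomb m (c ∘ suc) (λ i → g (suc i) · u) j
      ≡⟨ cong₂ _⊕_ (sym (*-assoc _ _ _)) (lincomb-multiples m (c ∘ suc) (g ∘ suc) u j) ⟩
    (c zero ⊗ g zero) ⊗ u j ⊕ dot m (c ∘ suc) (g ∘ suc) ⊗ u j
      ≡⟨ sym (distribʳ _ _ _) ⟩
    (c zero ⊗ g zero ⊕ dot m (c ∘ suc) (g ∘ suc)) ⊗ u j
      ∎

  lincomb-insertAt : ∀ m (p : Fin (suc m)) (S : F) (c : Fin m → F) (w : Fin (suc m) → V) →
                     (lincomb m c (w ∘ punchIn p) +V (S · w p)) ≈ lincomb (suc m) (insertAt c p S) w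
  lincomb-insertAt m       zero    S c w j = +-comm _ _
  lincomb-insertAt (suc m) (suc p) S c w j = begin
    (c zero ⊗ w zero j ⊕ lincomb m (c ∘ suc) (w ∘ suc ∘ punchIn p) j) ⊕ S ⊗ w (suc p) j
      ≡⟨ +-assoc _ _ _ ⟩
    c zero ⊗ w zero j ⊕ (lincomb m (c ∘ suc) (w ∘ suc ∘ punchIn p) j ⊕ S ⊗ w (suc p) j)
      ≡⟨ cong (c zero ⊗ w zero j ⊕_) (lincomb-insertAt m p S (c ∘ suc) (w ∘ suc) j) ⟩
    c zero ⊗ w zero j ⊕ lincomb (suc m) (insertAt (c ∘ suc) p S) (w ∘ suc) j
      ∎

  KSpan : ∀ d → (Fin d → V) → Pred
  KSpan d b u = Σ (Fin d → F) λ c → (∀ i → K (c i)) × (u ≈ lincomb d c b)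

  KSpan-subspace : ∀ d (b : Fin d → V) → IsFqSubspace (KSpan d b)
  KSpan-subspace d b = respects , zero∈ , +-closed , ·-closed
    where
      respects : ∀ u w → u ≈ w → KSpan d b u → KSpan d b w
      respects u w u≈w (c , Kc , u≈) = c , Kc , ≈-trans (≈-sym u≈w) u≈
      zero∈ : KSpan d b 0V
      zero∈ = (λ _ → 0#) , (λ _ → K-0) , ≈-sym (lincomb-zero d b)
      +-closed : ∀ u w → KSpan d b u → KSpan d b w → KSpan d b (u +V w)
      +-closed u w (c , Kc , u≈) (c′ , Kc′ , w≈) =
        (λ i → c i ⊕ c′ i) , (λ i → K-+ _ _ (Kc i) (Kc′ i)) ,
        ≈-trans (λ j → cong₂ _⊕_ (u≈ j) (w≈ j)) (≈-sym (lincomb-+ d c c′ b))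
      ·-closed : ∀ a u → K a → KSpan d b u → KSpan d b (a · u)
      ·-closed a u Ka (c , Kc , u≈) =
        (λ i → a ⊗ c i) , (λ i → K-* _ _ Ka (Kc i)) ,
        ≈-trans (λ j → cong (a ⊗_) (u≈ j)) (≈-sym (lincomb-scale d a c b))

  subspace-lincomb : ∀ {Y} → IsFqSubspace Y → ∀ d (b : Fin d → V) → (∀ i → Y (b i)) →
                     ∀ c → (∀ i → K (c i)) → Y (lincomb d c b)
  subspace-lincomb (_ , 0∈Y , _ , _) zero b b∈Y c Kc = 0∈Y
  subspace-lincomb Y-sub@(_ , _ , +-closed , ·-closed) (suc d) b b∈Y c Kc =
    +-closed _ _ (·-closed _ _ (Kc zero) (b∈Y zero))
                 (subspace-lincomb Y-sub d (b ∘ suc) (b∈Y ∘ suc) (c ∘ suc) (Kc ∘ suc))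

  KSpan? : ∀ d (b : Fin d → V) u → Dec (KSpan d b u)
  KSpan? d b u = search d (λ c → (∀ i → K (c i)) × (u ≈ lincomb d c b))
    (λ c≗c′ (Kc , u≈) → (λ i → subst K (c≗c′ i) (Kc i)) , ≈-trans u≈ (lincomb-cong d b c≗c′))
    (λ c → all? (λ i → T? (inK (c i))) ×-dec all? (λ j → u j ≟F lincomb d c b j))

  -- Counting: if d vectors F_q-span all of V, then q^{rn} = |V| ≤ |F_q^d| = q^d, so rn ≤ d.
  -- The injection V → F_q^d sends a vector to its coordinates.
  spanning-bound : ∀ d (b : Fin d → V) → (∀ u → KSpan d b u) → r * n ≤ d
  spanning-bound d b spans = ^-reflects-≤ {q} {n} {r} 1<q (injective⇒≤ code-injective)
    where
      toK : Σ F K → Fin q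
      toK = Inverse.to K-card
      coords : V → Fin d → Fin q
      coords u k = toK (proj₁ (spans u) k , proj₁ (proj₂ (spans u)) k)
      code : Fin ((q ^ n) ^ r) → Fin (q ^ d)
      code i = funToFin (coords (decode i))
      same-coefficients : ∀ u w → (∀ k → coords u k ≡ coords w k) → u ≈ w
      same-coefficients u w eq =
        ≈-trans (proj₂ (proj₂ (spans u)))
          (≈-trans (lincomb-cong d b λ k → cong proj₁ (Injection.injective (Inverse⇒Injection K-card) (eq k)))
                   (≈-sym (proj₂ (proj₂ (spans w)))))
      code-injective : ∀ {i i′} → code i ≡ code i′ → i ≡ i′
      code-injective {i} {i′} eq = decode-injective {r} (same-coefficients (decode i) (decode i′) λ k →
        trans (sym (finToFun-funToFin (coords (decode i)) k))
              (trans (cong (λ x → finToFun x k) eq) (finToFun-funToFin (coords (decode i′)) k)))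

  outside-span : ∀ d (b : Fin d → V) → d < r * n → Σ V λ v → ¬ KSpan d b v
  outside-span d b d<rn with search r (λ u → ¬ KSpan d b u)
    (λ u≈w u∉ w∈ → u∉ (proj₁ (KSpan-subspace d b) _ _ (≈-sym u≈w) w∈))
    (λ u → ¬? (KSpan? d b u))
  ... | yes v∉ = v∉
  ... | no none = ⊥-elim (ℕ.<⇒≱ d<rn (spanning-bound d b λ u →
                    decidable-stable (KSpan? d b u) λ u∉ → none (u , u∉)))

  -- A relation Σ c_i (w_{p↑i} + γ_i w_p) = 0
  -- is the relation on w with coefficients c and Σ c_i γ_i inserted at p.
  row-operations-independent : ∀ m (w : Fin (suc m) → V) → IndepK (suc m) w →
    (p : Fin (suc m)) (γ : Fin m → F) → (∀ i → K (γ i)) →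
    IndepK m (λ i → w (punchIn p i) +V (γ i · w p))
  row-operations-independent m w w-indep p γ Kγ c Kc relation i = begin
    c i                           ≡⟨ sym (insertAt-punchIn c p S i) ⟩
    insertAt c p S (punchIn p i)  ≡⟨ w-indep (insertAt c p S) K-coefficients relation-on-w (punchIn p i) ⟩
    0#                            ∎
    where
      S : F
      S = dot m c γ
      K-coefficients : ∀ j → K (insertAt c p S j)
      K-coefficients = insertAt-all K c p S (dot-K m c γ Kc Kγ) Kc
      relation-on-w : lincomb (suc m) (insertAt c p S) w ≈ 0V
      relation-on-w = ≈-trans (≈-sym (lincomb-insertAt m p S c w))
                      (≈-trans (λ j → cong (lincomb m c (w ∘ punchIn p) j ⊕_) (sym (lincomb-multiples m c γ (w p) j)))
                      (≈-trans (≈-sym (lincomb-+V m c (w ∘ punchIn p) (λ i → γ i · w p))) relation))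

  _+⟨_⟩ : Pred → V → Pred
  (Y +⟨ v ⟩) u = Σ F λ a → K a × Σ V λ y → Y y × (u ≈ ((a · v) +V y))

  eliminate : ∀ {Y W} v → IsFqSubspace Y → IsFqnSubspace W → ∀ m (w : Fin (suc m) → V) →
              (∀ i → ((Y +⟨ v ⟩) ∩ W) (w i)) → IndepK (suc m) w →
              Σ (Fin m → V) λ w′ → (∀ i → (Y ∩ W) (w′ i)) × IndepK m w′
  eliminate {Y} {W} v (Y-resp , _ , Y-+ , Y-·) (_ , _ , W-+ , W-·) m w w∈ w-indep =
    w′ , (λ i → w′∈Y i , w′∈W i) , row-operations-independent m w w-indep p γ Kγ
    where
      a : Fin (suc m) → F
      a i = proj₁ (proj₁ (w∈ i))
      y : Fin (suc m) → V
      y i = proj₁ (proj₂ (proj₂ (proj₁ (w∈ i))))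
      y∈Y : ∀ i → Y (y i)
      y∈Y i = proj₁ (proj₂ (proj₂ (proj₂ (proj₁ (w∈ i)))))
      w≈ : ∀ i → w i ≈ ((a i · v) +V y i)
      w≈ i = proj₂ (proj₂ (proj₂ (proj₂ (proj₁ (w∈ i)))))
      piv : Pivot m a
      piv = pivot m a (λ i → proj₁ (proj₂ (proj₁ (w∈ i))))
      p : Fin (suc m)
      p = proj₁ piv
      γ : Fin m → F
      γ = proj₁ (proj₂ piv)
      Kγ : ∀ i → K (γ i)
      Kγ = proj₁ (proj₂ (proj₂ piv))
      w′ : Fin m → V
      w′ i = w (punchIn p i) +V (γ i · w p)
      w′≈ : ∀ i → w′ i ≈ (y (punchIn p i) +V (γ i · y p))
      w′≈ i j = trans (cong₂ (λ x x′ → x ⊕ γ i ⊗ x′) (w≈ (punchIn p i) j) (w≈ p j))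
                      (row-operation _ _ _ (v j) _ _ (proj₂ (proj₂ (proj₂ piv)) i))
      w′∈Y : ∀ i → Y (w′ i)
      w′∈Y i = Y-resp _ _ (≈-sym (w′≈ i)) (Y-+ _ _ (y∈Y _) (Y-· _ _ (Kγ i) (y∈Y p)))
      w′∈W : ∀ i → W (w′ i)
      w′∈W i = W-+ _ _ (proj₂ (w∈ _)) (W-· _ _ (proj₂ (w∈ p)))

  dim-adjoin : ∀ {Y W} v k → IsFqSubspace Y → IsFqnSubspace W →
               DimFq≤ (Y ∩ W) k → DimFq≤ ((Y +⟨ v ⟩) ∩ W) (suc k)
  dim-adjoin v k Y-sub W-sub bound zero    w w∈ w-indep = z≤n
  dim-adjoin v k Y-sub W-sub bound (suc m) w w∈ w-indep =
    let (w′ , w′∈ , w′-indep) = eliminate v Y-sub W-sub m w w∈ w-indep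
    in s≤s (bound m w′ w′∈ w′-indep)

  cons-independent : ∀ d (b : Fin d → V) v → IndepK d b → ¬ KSpan d b v → IndepK (suc d) (v ∷ b)
  cons-independent d b v b-indep v∉ c Kc relation with c zero ≟F 0#
  ... | yes c₀≡0 = λ { zero → c₀≡0 ; (suc i) → b-indep (c ∘ suc) (Kc ∘ suc) tail-relation i }
    where
      tail-relation : lincomb d (c ∘ suc) b ≈ 0V
      tail-relation j = begin
        lincomb d (c ∘ suc) b j                 ≡⟨ sym (+-identityˡ _) ⟩
        0# ⊕ lincomb d (c ∘ suc) b j            ≡⟨ cong (_⊕ lincomb d (c ∘ suc) b j) (sym (trans (cong (_⊗ v j) c₀≡0) (zeroˡ (v j)))) ⟩
        c zero ⊗ v j ⊕ lincomb d (c ∘ suc) b j  ≡⟨ relation j ⟩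
        0#                                      ∎
  ... | no c₀≢0 = ⊥-elim (v∉ ((λ i → ⊖ β ⊗ c (suc i)) , (λ i → K-* _ _ (K-neg _ Kβ) (Kc (suc i))) ,
                             ≈-trans v≈ (≈-sym (lincomb-scale d (⊖ β) (c ∘ suc) b))))
    where
      β : F
      β = proj₁ (inverse (c zero) c₀≢0)
      Kβ : K β
      Kβ = K-inv (c zero) c₀≢0 (Kc zero)
      L : V
      L = lincomb d (c ∘ suc) b
      -- from  c₀ v + L = 0  we get  v = -c₀⁻¹ L
      v≈ : v ≈ ((⊖ β) · L)
      v≈ j = begin
        v j                 ≡⟨ sym (*-identityˡ _) ⟩
        1# ⊗ v j            ≡⟨ cong (_⊗ v j) (sym (trans (*-comm β (c zero)) (proj₂ (inverse (c zero) c₀≢0)))) ⟩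
        (β ⊗ c zero) ⊗ v j  ≡⟨ *-assoc _ _ _ ⟩
        β ⊗ (c zero ⊗ v j)  ≡⟨ cong (β ⊗_) (inverseˡ-unique _ _ (relation j)) ⟩
        β ⊗ ⊖ L j           ≡⟨ sym (-‿distribʳ-* β (L j)) ⟩
        ⊖ (β ⊗ L j)         ≡⟨ -‿distribˡ-* β (L j) ⟩
        ⊖ β ⊗ L j           ∎

  KSpan-⊆-cons : ∀ d (b : Fin d → V) v → KSpan d b ⊆ KSpan (suc d) (v ∷ b)
  KSpan-⊆-cons d b v u (c , Kc , u≈) =
    (0# ∷ c) , (λ { zero → K-0 ; (suc i) → Kc i }) ,
    λ j → trans (u≈ j) (sym (trans (cong (_⊕ lincomb d c b j) (zeroˡ (v j))) (+-identityˡ _)))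

  KSpan-cons-⊆ : ∀ {Y} d (b : Fin d → V) v → IsFqSubspace Y → (∀ i → Y (b i)) →
                 KSpan (suc d) (v ∷ b) ⊆ (Y +⟨ v ⟩)
  KSpan-cons-⊆ d b v Y-sub b∈Y u (c , Kc , u≈) =
    c zero , Kc zero , lincomb d (c ∘ suc) b , subspace-lincomb Y-sub d b b∈Y (c ∘ suc) (Kc ∘ suc) , u≈

  SpanFqn-mono : ∀ {X X′} → X ⊆ X′ → SpanFqn X ⊆ SpanFqn X′
  SpanFqn-mono X⊆X′ u (m , w , c , w∈ , u≈) = m , w , c , (λ i → X⊆X′ _ (w∈ i)) , u≈

  DimFq≤-antitone : ∀ {X X′} k → X ⊆ X′ → DimFq≤ X′ k → DimFq≤ X k
  DimFq≤-antitone k X⊆X′ bound m w w∈ = bound m w (λ i → X⊆X′ _ (w∈ i))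

  adjoin : ∀ {h k d Y} → Evasive h k Y → (basis : HasDimFq Y d) → ∀ v → ¬ KSpan d (proj₁ basis) v →
           Σ Pred λ Z → Evasive h (suc k) Z × HasDimFq Z (suc d)
  adjoin {h} {k} {d} {Y} (Y-sub , (g , g∈ , g-indep) , bound) (b , b∈Y , b-indep , b-spans) v v∉ =
    Z , (KSpan-subspace (suc d) (v ∷ b) , (g , (λ i → SpanFqn-mono Y⊆Z _ (g∈ i)) , g-indep) , Z-bound) ,
    ((v ∷ b) , v∷b∈Z , cons-independent d b v b-indep v∉ , λ u u∈Z → u∈Z)
    where
      Z : Pred
      Z = KSpan (suc d) (v ∷ b)
      Y⊆Z : Y ⊆ Z
      Y⊆Z u u∈Y = KSpan-⊆-cons d b v u (b-spans u u∈Y)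
      v∷b∈Z : ∀ i → Z ((v ∷ b) i)
      v∷b∈Z zero    = (1# ∷ λ _ → 0#) , (λ { zero → K-1 ; (suc i) → K-0 }) ,
                      λ j → sym (trans (cong₂ _⊕_ (*-identityˡ _) (lincomb-zero d b j)) (+-identityʳ _))
      v∷b∈Z (suc i) = Y⊆Z _ (b∈Y i)
      Z-bound : ∀ W → IsFqnSubspace W → HasDimFqn W h → DimFq≤ (Z ∩ W) (suc k)
      Z-bound W W-sub W-dim =
        DimFq≤-antitone {Z ∩ W} {(Y +⟨ v ⟩) ∩ W} (suc k) (λ u (u∈Z , u∈W) → KSpan-cons-⊆ d b v Y-sub b∈Y u u∈Z , u∈W)
                                (dim-adjoin v k Y-sub W-sub (bound W W-sub W-dim))

  extend-by-one : ∀ {h k d Y} → Evasive h k Y → HasDimFq Y d → d < r * n →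
                  Σ Pred λ Z → Evasive h (suc k) Z × HasDimFq Z (suc d)
  extend-by-one {d = d} Y-ev basis d<rn =
    let (v , v∉) = outside-span d (proj₁ basis) d<rn in adjoin Y-ev basis v v∉

  extend : ∀ {h k t Y} → Evasive h k Y → HasDimFq Y t → ∀ s → s ≤ r * n ∸ t →
           Σ Pred λ Z → Evasive h (s + k) Z × HasDimFq Z (s + t)
  extend Y-ev basis zero    _  = _ , Y-ev , basis
  extend {t = t} Y-ev basis (suc s) s<rn∸t =
    let (Z , Z-ev , Z-basis) = extend Y-ev basis s (ℕ.<⇒≤ s<rn∸t)
    in extend-by-one Z-ev Z-basis (room-for-one-more s t (r * n) s<rn∸t)

proposition2p7 : ∀ {q n : ℕ} (E : FieldExt q n) (r h k t : ℕ) →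
    0 < h → 0 < k →
    let open VSpace E r in
    Σ Pred (λ U → Evasive h k U × HasDimFq U t) →
    ∀ (s : ℕ) → s ≤ r * n ∸ t →
    Σ Pred (λ U′ → Evasive h (k + s) U′ × HasDimFq U′ (t + s))
proposition2p7 E r h k t _ _ (U , U-ev , U-dim) s s≤rn∸t =
  subst₂ (λ k′ t′ → Σ Pred λ U′ → Evasive h k′ U′ × HasDimFq U′ t′)
         (ℕ.+-comm s k) (ℕ.+-comm s t)
         (extend U-ev U-dim s s≤rn∸t)
  where
    open VSpace E r
    open Extension E r
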